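{- Let $r\ge 1$, let $A$ be a list of $r$-coordinates that is sorted under a complete ordering $\tau=(\tau_1,\ldots,\tau_r)$, let $0\le l<k\le r$, and let $p=\tau_k$. Let $A'$ be the result of calling $\textsc{PartialSort}(A,(\tau_1,\ldots,\tau_l),p)$, which is sorted under the complete ordering $$\tau'=(\tau_1,\ldots,\tau_l,\tau_k,\tau_{l+1},\ldots,\tau_{k-1},\tau_{k+1},\ldots,\tau_r).$$ Then for every mode $q\in\{1,\ldots,r\}$ with $q\neq p$, we have $f(\tau',q)\subseteq f(\tau,q)$.
   Context: An $r$-coordinate is a tuple $i=(i_1,\ldots,i_r)$ of integers with $1\le i_m\le n_m$; position $m$ is called mode $m$. An ordering is a tuple $\sigma$ of distinct modes; it is complete if it contains all $r$ modes (i.e. it is a permutation of $(1,\ldots,r)$). Coordinates are compared lexicographically under $\sigma$: $i<i'$ under $\sigma$ if $i_{\sigma_1}<i'_{\sigma_1}$, or $i_{\sigma_1}=i'_{\sigma_1}$ and $i<i'$ under $(\sigma_2,\sigma_3,\ldots)$; all tuples are equal under the empty ordering $()$. A list of coordinates is sorted under $\sigma$ if it is nondecreasing in this order. For a list $A$ sorted under a complete ordering $\tau$ and $0\le l<k\le r$, $\textsc{PartialSort}(A,(\tau_1,\ldots,\tau_l),\tau_k)$ is the partial-sort primitive that returns the coordinates of $A$ rearranged so as to be sorted under $(\tau_1,\ldots,\tau_l,\tau_k,\tau_{l+1},\ldots,\tau_{k-1},\tau_{k+1},\ldots,\tau_r)$ (for $l=0$ this is $(\tau_k,\tau_1,\ldots,\tau_{k-1},\tau_{k+1},\ldots,\tau_r)$;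 the $l=0$ call is called non-bucketed and the $l\ge1$ call bucketed). For a complete ordering $\tau$ and a mode $p$ with $\tau_k=p$, define $f(\tau,p)=\{\tau_{k+1},\ldots,\tau_r\}$, the set of modes following $p$ in $\tau$ (e.g. $f((1,3,2,4),3)=\{2,4\}$). -}

module Defs where

open import Data.Nat using (ℕ; zero; suc; _<_; _≤_)
open import Data.Fin using (Fin; _≟_)
open import Data.Vec using (Vec; lookup)
open import Data.List using (List; []; _∷_; _++_; take; drop; allFin)
open import Data.Maybe using (Maybe; just; nothing)
open import Data.Product using (_×_)
open import Data.Sum using (_⊎_)
open import Data.Unit using (⊤)
open import Relation.Nullary using (yes; no)
open import Relation.Binary.PropositionalEquality using (_≡_)
open import Data.List.Relation.Binary.Permutation.Propositional using (_↭_)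

-- Modes are Fin r (mode m+1 of the paper is the Fin element m).
Mode : ℕ → Set
Mode r = Fin r

Ordering : ℕ → Set
Ordering r = List (Mode r)

Complete : {r : ℕ} → Ordering r → Set
Complete {r} τ = τ ↭ allFin r

Coord : ℕ → Set
Coord r = Vec ℕ r

ValidCoord : {r : ℕ} → Vec ℕ r → Coord r → Set
ValidCoord n i = ∀ m → (1 ≤ lookup i m) × (lookup i m ≤ lookup n m)

LexLe : {r : ℕ} → Ordering r → Coord r → Coord r → Set
LexLe []      i i' = ⊤
LexLe (m ∷ σ) i i' = (lookup i m < lookup i' m) ⊎ ((lookup i m ≡ lookup i' m) × LexLe σ i i')

data SortedUnder {r : ℕ} (σ : Ordering r) : List (Coord r) → Set where
  [] : SortedUnder σ []
  [-] : ∀ {i} → SortedUnder σ (i ∷ [])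
  _∷_ : ∀ {i i' A} → LexLe σ i i' → SortedUnder σ (i' ∷ A) → SortedUnder σ (i ∷ i' ∷ A)

-- 1-indexed access: at τ k = just τ_k when 1 ≤ k ≤ length τ.
at : {A : Set} → List A → ℕ → Maybe A
at []       _             = nothing
at (x ∷ xs) zero          = nothing
at (x ∷ xs) (suc zero)    = just x
at (x ∷ xs) (suc (suc k)) = at xs (suc k)

-- τ' = (τ_1,…,τ_l, τ_k, τ_{l+1},…,τ_{k-1}, τ_{k+1},…,τ_r), given p = τ_k.
moved : {r : ℕ} → Ordering r → ℕ → ℕ → Mode r → Ordering r
moved τ l k p = take l τ ++ (p ∷ (drop l (take (Data.Nat._∸_ k 1) τ) ++ drop k τ))

-- f(τ,p): the modes following p in τ (as a list; empty if p does not occur).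
after : {r : ℕ} → Ordering r → Mode r → List (Mode r)
after []      p = []
after (x ∷ τ) p with x ≟ p
... | yes _ = τ
... | no  _ = after τ p

-- PartialSort(A,(τ_1,…,τ_l),τ_k): a rearrangement of A sorted under τ'.
IsPartialSort : {r : ℕ} → List (Coord r) → Ordering r → ℕ → ℕ → Mode r → List (Coord r) → Set
IsPartialSort A τ l k p A' = (A' ↭ A) × SortedUnder (moved τ l k p) A'

-- Write τ = xs ++ ys ++ p ∷ zs with |xs| = l, so that τ' = xs ++ p ∷ ys ++ zs:
-- τ' moves p forward past ys.
module Submission where

open import Defs
open import Data.Nat using (ℕ; _<_; _≤_; suc; s≤s; _∸_; _⊓_)
open import Data.Nat.Properties using (m≤n⇒m⊓n≡m)
open import Data.Vec using (Vec)
open import Data.Fin using (_≟_)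
open import Data.List using (List; []; _∷_; _++_; take; drop)
open import Data.List.Properties using (take++drop≡id; take-take; ++-assoc)
open import Data.List.Relation.Unary.All using (All)
open import Data.List.Relation.Binary.Subset.Propositional using (_⊆_)
open import Data.List.Relation.Binary.Subset.Propositional.Properties
  using (⊆-trans; ⊆-reflexive; ⊆-reflexive-↭; xs⊆x∷xs; ++⁺ʳ)
open import Data.List.Relation.Binary.Permutation.Propositional using (↭-sym)
open import Data.List.Relation.Binary.Permutation.Propositional.Properties
  using (shift; ++⁺ˡ)
open import Data.Maybe using (just)
open import Function using (_∘_)
open import Relation.Nullary using (yes; no; contradiction)
open import Relation.Binary.PropositionalEquality
  using (_≡_; _≢_; refl; sym; cong; module ≡-Reasoning)

module _ {A : Set} where

  at-split : ∀ j (xs : List A) {p : A} →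
             at xs (suc j) ≡ just p → xs ≡ take j xs ++ p ∷ drop (suc j) xs
  at-split _       []       ()
  at-split 0       (x ∷ xs) refl = refl
  at-split (suc j) (x ∷ xs) eq   = cong (x ∷_) (at-split j xs eq)

  take-split : ∀ {l j} (xs : List A) → l ≤ j →
               take j xs ≡ take l xs ++ drop l (take j xs)
  take-split {l} {j} xs l≤j = begin
    take j xs                                ≡⟨ take++drop≡id l (take j xs) ⟨
    take l (take j xs) ++ drop l (take j xs) ≡⟨ cong (_++ drop l (take j xs)) (take-take l j xs) ⟩
    take (l ⊓ j) xs ++ drop l (take j xs)    ≡⟨ cong (λ m → take m xs ++ drop l (take j xs)) (m≤n⇒m⊓n≡m l≤j) ⟩
    take l xs ++ drop l (take j xs)          ∎
    where open ≡-Reasoning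

module _ {r : ℕ} where

  moved-source : ∀ {l k} (τ : Ordering r) {p : Mode r} → l < k → at τ k ≡ just p →
                 τ ≡ take l τ ++ drop l (take (k ∸ 1) τ) ++ p ∷ drop k τ
  moved-source {l} {suc j} τ {p} (s≤s l≤j) eq = begin
    τ                                                    ≡⟨ at-split j τ eq ⟩
    take j τ ++ p ∷ drop (suc j) τ                       ≡⟨ cong (_++ p ∷ drop (suc j) τ) (take-split τ l≤j) ⟩
    (take l τ ++ drop l (take j τ)) ++ p ∷ drop (suc j) τ ≡⟨ ++-assoc (take l τ) _ _ ⟩
    take l τ ++ drop l (take j τ) ++ p ∷ drop (suc j) τ   ∎
    where open ≡-Reasoning

  after-∷-≢ : ∀ {x q : Mode r} (xs : Ordering r) → x ≢ q → after (x ∷ xs) q ≡ after xs q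
  after-∷-≢ {x} {q} xs x≢q with x ≟ q
  ... | yes x≡q = contradiction x≡q x≢q
  ... | no  _   = refl

  after-insert : ∀ (ys zs : Ordering r) {p q : Mode r} → p ≢ q →
                 after (ys ++ zs) q ⊆ after (ys ++ p ∷ zs) q
  after-insert []       zs         p≢q = ⊆-reflexive (sym (after-∷-≢ zs p≢q))
  after-insert (y ∷ ys) zs {p} {q} p≢q with y ≟ q
  ... | yes _ = ++⁺ʳ ys (xs⊆x∷xs zs p)
  ... | no  _ = after-insert ys zs p≢q

  after-move-forward : ∀ (xs ys zs : Ordering r) {p q : Mode r} → p ≢ q →
                       after (xs ++ p ∷ ys ++ zs) q ⊆ after (xs ++ ys ++ p ∷ zs) q
  after-move-forward []       ys zs         p≢q =
    ⊆-trans (⊆-reflexive (after-∷-≢ (ys ++ zs) p≢q)) (after-insert ys zs p≢q)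
  after-move-forward (x ∷ xs) ys zs {p} {q} p≢q with x ≟ q
  ... | yes _ = ⊆-reflexive-↭ (++⁺ˡ xs (↭-sym (shift p ys zs)))
  ... | no  _ = after-move-forward xs ys zs p≢q

lemma3p1 : (r : ℕ) → 1 ≤ r → (n : Vec ℕ r) → (A : List (Coord r)) → All (ValidCoord n) A
    → (τ : Ordering r) → Complete τ → SortedUnder τ A
    → (l k : ℕ) → l < k → k ≤ r → (p : Mode r) → at τ k ≡ just p
    → (A' : List (Coord r)) → IsPartialSort A τ l k p A'
    → (q : Mode r) → q ≢ p → after (moved τ l k p) q ⊆ after τ q
lemma3p1 r _ n A _ τ _ _ l k l<k _ p τₖ≡p A' _ q q≢p =
  ⊆-trans (after-move-forward (take l τ) (drop l (take (k ∸ 1) τ)) (drop k τ) (q≢p ∘ sym))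
          (⊆-reflexive (cong (λ σ → after σ q) (sym (moved-source τ l<k τₖ≡p))))
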